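{- Let $\mathbf{A}=\langle A,\land,\lor,\Rightarrow,\neg,0,1\rangle$ be an $\mathcal{S}$-algebra, and define the binary operation $x*y:=\neg(x\Rightarrow\neg y)$ on $A$. Then $\mathbf{A}'=\langle A,\land,\lor,*,\Rightarrow,0,1\rangle$ is an $\mathcal{S}'$-algebra.
   Context: Nelson's logic $\mathcal S$ is the sentential logic in the language $\langle\land,\lor,\Rightarrow,\neg,0\rangle$ (types $2,2,2,1,0$) given by the following Hilbert-style calculus. Abbreviations: $\phi\Leftrightarrow\psi:=(\phi\Rightarrow\psi)\land(\psi\Rightarrow\phi)$, $1:=\neg 0$, $\phi\Rightarrow^2\psi:=\phi\Rightarrow(\phi\Rightarrow\psi)$; for a finite (possibly empty) list $\Gamma=(\phi_1,\dots,\phi_n)$ of formulas, $\Gamma\Rightarrow\phi:=\phi_1\Rightarrow(\phi_2\Rightarrow(\cdots(\phi_n\Rightarrow\phi)\cdots))$ and $\Gamma\Rightarrow^2\phi:=\phi_1\Rightarrow^2(\phi_2\Rightarrow^2(\cdots(\phi_n\Rightarrow^2\phi)\cdots))$, both being $\phi$ if $\Gamma$ is empty. Axiom schemata: (A1) $\phi\Rightarrow\phi$; (A2) $0\Rightarrow\psi$; (A3) $\neg\phi\Rightarrow(\phi\Rightarrow0)$; (A4) $1$; (A5) $(\phi\Rightarrow\psi)\Leftrightarrow(\neg\psi\Rightarrow\neg\phi)$. Rule schemata (for all formulas and every finite list $\Gamma$), written "premisses / conclusion": (P) $\Gamma\Rightarrow(\phi\Rightarrow(\psi\Rightarrow\gamma))$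 / $\Gamma\Rightarrow(\psi\Rightarrow(\phi\Rightarrow\gamma))$; (C) $\phi\Rightarrow(\phi\Rightarrow(\phi\Rightarrow\gamma))$ / $\phi\Rightarrow(\phi\Rightarrow\gamma)$; (E) $\Gamma\Rightarrow\phi$, $\phi\Rightarrow\gamma$ / $\Gamma\Rightarrow\gamma$; ($\Rightarrow$l) $\Gamma\Rightarrow\phi$, $\psi\Rightarrow\gamma$ / $\Gamma\Rightarrow((\phi\Rightarrow\psi)\Rightarrow\gamma)$; ($\Rightarrow$r) $\gamma$ / $\phi\Rightarrow\gamma$; ($\land$l1) $\phi\Rightarrow\gamma$ / $(\phi\land\psi)\Rightarrow\gamma$; ($\land$l2) $\psi\Rightarrow\gamma$ / $(\phi\land\psi)\Rightarrow\gamma$; ($\land$r) $\Gamma\Rightarrow\phi$, $\Gamma\Rightarrow\psi$ / $\Gamma\Rightarrow(\phi\land\psi)$; ($\lor$l1) $\phi\Rightarrow\gamma$, $\psi\Rightarrow\gamma$ / $(\phi\lor\psi)\Rightarrow\gamma$; ($\lor$l2) $\phi\Rightarrow^2\gamma$, $\psi\Rightarrow^2\gamma$ / $(\phi\lor\psi)\Rightarrow^2\gamma$; ($\lor$r1) $\Gamma\Rightarrow\phi$ / $\Gamma\Rightarrow(\phi\lor\psi)$; ($\lor$r2) $\Gamma\Rightarrow\psi$ / $\Gamma\Rightarrow(\phi\lor\psi)$; ($\neg\Rightarrow$l) $(\phi\land\neg\psi)\Rightarrow\gamma$ / $\neg(\phi\Rightarrow\psi)\Rightarrow\gamma$; ($\neg\Rightarrow$r)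 $\Gamma\Rightarrow^2(\phi\land\neg\psi)$ / $\Gamma\Rightarrow^2\neg(\phi\Rightarrow\psi)$; ($\neg\land$l) $(\neg\phi\lor\neg\psi)\Rightarrow\gamma$ / $\neg(\phi\land\psi)\Rightarrow\gamma$; ($\neg\land$r) $\Gamma\Rightarrow(\neg\phi\lor\neg\psi)$ / $\Gamma\Rightarrow\neg(\phi\land\psi)$; ($\neg\lor$l) $(\neg\phi\land\neg\psi)\Rightarrow\gamma$ / $\neg(\phi\lor\psi)\Rightarrow\gamma$; ($\neg\lor$r) $\Gamma\Rightarrow(\neg\phi\land\neg\psi)$ / $\Gamma\Rightarrow\neg(\phi\lor\psi)$; ($\neg\neg$l) $\phi\Rightarrow\gamma$ / $\neg\neg\phi\Rightarrow\gamma$; ($\neg\neg$r) $\Gamma\Rightarrow\phi$ / $\Gamma\Rightarrow\neg\neg\phi$. An $\mathcal S$-algebra is an algebra $\langle A,\land,\lor,\Rightarrow,\neg,0,1\rangle$ of type $\langle2,2,2,1,0,0\rangle$ satisfying: (i) $\varphi\approx1$ for every axiom (A1)–(A5) of $\mathcal S$, formulas being read as terms and the abbreviation $1:=\neg0$ of the logic written out (so (A4) gives $\neg0\approx1$); (ii) $x\Rightarrow x\approx1$; (iii) for each rule of $\mathcal S$ with premisses $\varphi_1,\dots,\varphi_n$ and conclusion $\varphi$, the quasi-equation $(\varphi_1\approx1\ \&\cdots\&\ \varphi_n\approx1)\Longrightarrow\varphi\approx1$; (iv) $(x\Rightarrow y\approx1\ \&\ y\Rightarrow x\approx1)\Longrightarrow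 x\approx y$. A commutative integral residuated lattice (CIRL) is an algebra $\langle A,\land,\lor,*,\Rightarrow,1\rangle$ such that $\langle A,\land,\lor\rangle$ is a lattice with top element $1$, $\langle A,*,1\rangle$ is a commutative monoid, and $a*b\le c$ iff $b\le a\Rightarrow c$. A CIBRL is a CIRL with an extra constant $0$ that is the least element; set $\neg a:=a\Rightarrow0$. It is involutive if $\neg\neg x\approx x$, and three-potent if $a*a\le a*a*a$ for all $a$. An $\mathcal S'$-algebra is a three-potent involutive CIBRL $\langle A,\land,\lor,*,\Rightarrow,0,1\rangle$. -}

module Defs where

open import Level using (Level)
open import Data.List using (List; []; _∷_; foldr)
open import Data.Product using (_×_)
open import Relation.Binary.PropositionalEquality using (_≡_)
open import Algebra.Core using (Op₁; Op₂)
import Algebra.Lattice.Structures as LS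
import Algebra.Structures as AS

module _ {a : Level} {A : Set a} (_⇒_ : Op₂ A) where
  _⇒²_ : Op₂ A
  x ⇒² y = x ⇒ (x ⇒ y)

  ⇒L : List A → A → A
  ⇒L Γ φ = foldr _⇒_ φ Γ

  ⇒²L : List A → A → A
  ⇒²L Γ φ = foldr _⇒²_ φ Γ

-- S-algebras: the axioms, rules (for every finite list Γ) and the
-- antisymmetry quasi-equation, with formulas read as terms.
record IsSAlgebra {a : Level} {A : Set a}
                  (_∧_ _∨_ _⇒_ : Op₂ A) (¬_ : Op₁ A) (𝟘 𝟙 : A) : Set a where
  _⇔_ : Op₂ A
  x ⇔ y = (x ⇒ y) ∧ (y ⇒ x)
  _⇒'_ : List A → A → A
  _⇒'_ = ⇒L _⇒_
  _⇒²'_ : List A → A → A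
  _⇒²'_ = ⇒²L _⇒_
  _⇒2_ : Op₂ A
  _⇒2_ = _⇒²_ _⇒_
  field
    A1 : ∀ x → x ⇒ x ≡ 𝟙
    A2 : ∀ y → 𝟘 ⇒ y ≡ 𝟙
    A3 : ∀ x → (¬ x) ⇒ (x ⇒ 𝟘) ≡ 𝟙
    A4 : ¬ 𝟘 ≡ 𝟙
    A5 : ∀ x y → (x ⇒ y) ⇔ ((¬ y) ⇒ (¬ x)) ≡ 𝟙
    refl⇒ : ∀ x → x ⇒ x ≡ 𝟙
    rP : ∀ Γ φ ψ γ → Γ ⇒' (φ ⇒ (ψ ⇒ γ)) ≡ 𝟙 → Γ ⇒' (ψ ⇒ (φ ⇒ γ)) ≡ 𝟙
    rC : ∀ φ γ → φ ⇒ (φ ⇒ (φ ⇒ γ)) ≡ 𝟙 → φ ⇒ (φ ⇒ γ) ≡ 𝟙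
    rE : ∀ Γ φ γ → Γ ⇒' φ ≡ 𝟙 → φ ⇒ γ ≡ 𝟙 → Γ ⇒' γ ≡ 𝟙
    r⇒l : ∀ Γ φ ψ γ → Γ ⇒' φ ≡ 𝟙 → ψ ⇒ γ ≡ 𝟙 → Γ ⇒' ((φ ⇒ ψ) ⇒ γ) ≡ 𝟙
    r⇒r : ∀ φ γ → γ ≡ 𝟙 → φ ⇒ γ ≡ 𝟙
    r∧l1 : ∀ φ ψ γ → φ ⇒ γ ≡ 𝟙 → (φ ∧ ψ) ⇒ γ ≡ 𝟙
    r∧l2 : ∀ φ ψ γ → ψ ⇒ γ ≡ 𝟙 → (φ ∧ ψ) ⇒ γ ≡ 𝟙
    r∧r : ∀ Γ φ ψ → Γ ⇒' φ ≡ 𝟙 → Γ ⇒' ψ ≡ 𝟙 → Γ ⇒' (φ ∧ ψ) ≡ 𝟙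
    r∨l1 : ∀ φ ψ γ → φ ⇒ γ ≡ 𝟙 → ψ ⇒ γ ≡ 𝟙 → (φ ∨ ψ) ⇒ γ ≡ 𝟙
    r∨l2 : ∀ φ ψ γ → φ ⇒2 γ ≡ 𝟙 → ψ ⇒2 γ ≡ 𝟙 → (φ ∨ ψ) ⇒2 γ ≡ 𝟙
    r∨r1 : ∀ Γ φ ψ → Γ ⇒' φ ≡ 𝟙 → Γ ⇒' (φ ∨ ψ) ≡ 𝟙
    r∨r2 : ∀ Γ φ ψ → Γ ⇒' ψ ≡ 𝟙 → Γ ⇒' (φ ∨ ψ) ≡ 𝟙
    r¬⇒l : ∀ φ ψ γ → (φ ∧ (¬ ψ)) ⇒ γ ≡ 𝟙 → (¬ (φ ⇒ ψ)) ⇒ γ ≡ 𝟙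
    r¬⇒r : ∀ Γ φ ψ → Γ ⇒²' (φ ∧ (¬ ψ)) ≡ 𝟙 → Γ ⇒²' (¬ (φ ⇒ ψ)) ≡ 𝟙
    r¬∧l : ∀ φ ψ γ → ((¬ φ) ∨ (¬ ψ)) ⇒ γ ≡ 𝟙 → (¬ (φ ∧ ψ)) ⇒ γ ≡ 𝟙
    r¬∧r : ∀ Γ φ ψ → Γ ⇒' ((¬ φ) ∨ (¬ ψ)) ≡ 𝟙 → Γ ⇒' (¬ (φ ∧ ψ)) ≡ 𝟙
    r¬∨l : ∀ φ ψ γ → ((¬ φ) ∧ (¬ ψ)) ⇒ γ ≡ 𝟙 → (¬ (φ ∨ ψ)) ⇒ γ ≡ 𝟙
    r¬∨r : ∀ Γ φ ψ → Γ ⇒' ((¬ φ) ∧ (¬ ψ)) ≡ 𝟙 → Γ ⇒' (¬ (φ ∨ ψ)) ≡ 𝟙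
    r¬¬l : ∀ φ γ → φ ⇒ γ ≡ 𝟙 → (¬ (¬ φ)) ⇒ γ ≡ 𝟙
    r¬¬r : ∀ Γ φ → Γ ⇒' φ ≡ 𝟙 → Γ ⇒' (¬ (¬ φ)) ≡ 𝟙
    antisym : ∀ x y → x ⇒ y ≡ 𝟙 → y ⇒ x ≡ 𝟙 → x ≡ y

record IsS'Algebra {a : Level} {A : Set a}
                   (_∧_ _∨_ _*_ _⇒_ : Op₂ A) (𝟘 𝟙 : A) : Set a where
  _≤_ : A → A → Set a
  x ≤ y = x ∧ y ≡ x
  ¬_ : Op₁ A
  ¬ x = x ⇒ 𝟘
  field
    isLattice : LS.IsLattice {A = A} _≡_ _∨_ _∧_
    top : ∀ x → x ≤ 𝟙
    isCommutativeMonoid : AS.IsCommutativeMonoid {A = A} _≡_ _*_ 𝟙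
    residuation₁ : ∀ x y z → (x * y) ≤ z → y ≤ (x ⇒ z)
    residuation₂ : ∀ x y z → y ≤ (x ⇒ z) → (x * y) ≤ z
    bottom : ∀ x → 𝟘 ≤ x
    involutive : ∀ x → ¬ (¬ x) ≡ x
    three-potent : ∀ x → (x * x) ≤ ((x * x) * x)

module Submission where

-- Write  x ⊑ y  for  x ⇒ y ≡ 𝟙.  The rules of S make ⊑ a partial order in
-- which ∧ and ∨ are meet and join, so the lattice axioms are obtained from the
-- library's passage from order-theoretic to algebraic lattices.  Next, the
-- implication obeys exchange, 𝟙 ⇒ y ≡ y, contraposition and double negation
-- as *identities*.  Combining them gives residuation as an identity,
--     (x * y) ⇒ z ≡ y ⇒ (x ⇒ z),
-- and since an element a is determined by the function  w ↦ a ⇒ w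
-- (a "Yoneda" principle coming from antisymmetry), commutativity,
-- associativity and unitality of * reduce to exchange and 𝟙 ⇒ y ≡ y.
-- Three-potence is rule (C) read through residuation, and involutivity of
-- x ↦ x ⇒ 𝟘 is double negation, because  x ⇒ 𝟘 ≡ ¬ x  by contraposition.

open import Defs
open import Level using (Level)
open import Algebra.Core using (Op₁; Op₂)
open import Data.List using ([]; _∷_)
open import Data.Product using (_,_)
open import Relation.Binary.PropositionalEquality
open import Relation.Binary.Structures using (IsPartialOrder)
open import Relation.Binary.Lattice using (Lattice; IsLattice)
import Relation.Binary.Lattice.Properties.Lattice as LatticeProperties

module SAlgebraProperties
  {a : Level} {A : Set a} (_∧_ _∨_ _⇒_ : Op₂ A) (¬_ : Op₁ A) (𝟘 𝟙 : A)
  (S : IsSAlgebra _∧_ _∨_ _⇒_ ¬_ 𝟘 𝟙) where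

  open IsSAlgebra S
  open ≡-Reasoning

  _⊑_ : A → A → Set a
  x ⊑ y = x ⇒ y ≡ 𝟙

  modus-ponens : ∀ {x y} → x ≡ 𝟙 → x ⊑ y → y ≡ 𝟙
  modus-ponens {x} {y} = rE [] x y

  ⊑-trans : ∀ {x y z} → x ⊑ y → y ⊑ z → x ⊑ z
  ⊑-trans {x} {y} {z} = rE (x ∷ []) y z

  ⊑-isPartialOrder : IsPartialOrder _≡_ _⊑_
  ⊑-isPartialOrder = record
    { isPreorder = record
      { isEquivalence = isEquivalence
      ; reflexive     = λ { {x} refl → A1 x }
      ; trans         = ⊑-trans
      }
    ; antisym = antisym _ _
    }

  ⊑-isLattice : IsLattice _≡_ _⊑_ _∨_ _∧_
  ⊑-isLattice = record
    { isPartialOrder = ⊑-isPartialOrder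
    ; supremum = λ x y → r∨r1 (x ∷ []) x y (A1 x) , r∨r2 (y ∷ []) x y (A1 y)
                       , λ z → r∨l1 x y z
    ; infimum  = λ x y → r∧l1 x y x (A1 x) , r∧l2 x y y (A1 y)
                       , λ z → r∧r (z ∷ []) x y
    }

  ⊑-lattice : Lattice a a a
  ⊑-lattice = record { isLattice = ⊑-isLattice }

  open LatticeProperties ⊑-lattice using (isAlgLattice) public

  ⊑⇒∧-order : ∀ {x y} → x ⊑ y → x ∧ y ≡ x
  ⊑⇒∧-order {x} {y} x⊑y = antisym _ _ (r∧l1 x y x (A1 x)) (r∧r (x ∷ []) x y (A1 x) x⊑y)

  ∧-order⇒⊑ : ∀ {x y} → x ∧ y ≡ x → x ⊑ y
  ∧-order⇒⊑ {x} {y} x∧y≡x = subst (_⊑ y) x∧y≡x (r∧l2 x y y (A1 y))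

  exchange : ∀ x y z → x ⇒ (y ⇒ z) ≡ y ⇒ (x ⇒ z)
  exchange x y z = antisym _ _ (rP (x ⇒ (y ⇒ z) ∷ []) x y z (A1 _))
                               (rP (y ⇒ (x ⇒ z) ∷ []) y x z (A1 _))

  𝟙⇒ : ∀ y → 𝟙 ⇒ y ≡ y
  𝟙⇒ y = antisym _ _ (r⇒l [] 𝟙 y y refl (A1 y)) y⊑𝟙⇒y
    where
    y⊑𝟙⇒y : y ⊑ (𝟙 ⇒ y)
    y⊑𝟙⇒y = trans (exchange y 𝟙 y) (r⇒r 𝟙 (y ⇒ y) (A1 y))

  contraposition : ∀ x y → x ⇒ y ≡ (¬ y) ⇒ (¬ x)
  contraposition x y = antisym _ _
    (modus-ponens (A5 x y) (r∧l1 _ _ _ (A1 _)))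
    (modus-ponens (A5 x y) (r∧l2 _ _ _ (A1 _)))

  double-negation : ∀ x → ¬ (¬ x) ≡ x
  double-negation x = antisym _ _ (r¬¬l x x (A1 x)) (r¬¬r (x ∷ []) x (A1 x))

  ⇒𝟘≡¬ : ∀ x → x ⇒ 𝟘 ≡ ¬ x
  ⇒𝟘≡¬ x = begin
    x ⇒ 𝟘              ≡⟨ contraposition x 𝟘 ⟩
    (¬ 𝟘) ⇒ (¬ x)      ≡⟨ cong (_⇒ (¬ x)) A4 ⟩
    𝟙 ⇒ (¬ x)          ≡⟨ 𝟙⇒ (¬ x) ⟩
    ¬ x                ∎

  ¬-swap : ∀ x z → (¬ x) ⇒ z ≡ (¬ z) ⇒ x
  ¬-swap x z = begin
    (¬ x) ⇒ z          ≡⟨ contraposition (¬ x) z ⟩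
    (¬ z) ⇒ (¬ (¬ x))  ≡⟨ cong ((¬ z) ⇒_) (double-negation x) ⟩
    (¬ z) ⇒ x          ∎

  _*_ : Op₂ A
  x * y = ¬ (x ⇒ (¬ y))

  residuation : ∀ x y z → (x * y) ⇒ z ≡ y ⇒ (x ⇒ z)
  residuation x y z = begin
    (¬ (x ⇒ (¬ y))) ⇒ z  ≡⟨ ¬-swap (x ⇒ (¬ y)) z ⟩
    (¬ z) ⇒ (x ⇒ (¬ y))  ≡⟨ exchange (¬ z) x (¬ y) ⟩
    x ⇒ ((¬ z) ⇒ (¬ y))  ≡⟨ cong (x ⇒_) (sym (contraposition y z)) ⟩
    x ⇒ (y ⇒ z)          ≡⟨ exchange x y z ⟩
    y ⇒ (x ⇒ z)          ∎

  determined-by-implications : ∀ {x y} → (∀ w → x ⇒ w ≡ y ⇒ w) → x ≡ y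
  determined-by-implications {x} {y} same = antisym x y
    (trans (same y) (A1 y))
    (trans (sym (same x)) (A1 x))

  *-comm : ∀ x y → x * y ≡ y * x
  *-comm x y = determined-by-implications λ w → begin
    (x * y) ⇒ w      ≡⟨ residuation x y w ⟩
    y ⇒ (x ⇒ w)      ≡⟨ exchange y x w ⟩
    x ⇒ (y ⇒ w)      ≡⟨ sym (residuation y x w) ⟩
    (y * x) ⇒ w      ∎

  *-identityˡ : ∀ x → 𝟙 * x ≡ x
  *-identityˡ x = determined-by-implications λ w → begin
    (𝟙 * x) ⇒ w      ≡⟨ residuation 𝟙 x w ⟩
    x ⇒ (𝟙 ⇒ w)      ≡⟨ cong (x ⇒_) (𝟙⇒ w) ⟩
    x ⇒ w            ∎

  *-identityʳ : ∀ x → x * 𝟙 ≡ x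
  *-identityʳ x = trans (*-comm x 𝟙) (*-identityˡ x)

  *-assoc : ∀ x y z → (x * y) * z ≡ x * (y * z)
  *-assoc x y z = determined-by-implications λ w → begin
    ((x * y) * z) ⇒ w  ≡⟨ residuation (x * y) z w ⟩
    z ⇒ ((x * y) ⇒ w)  ≡⟨ cong (z ⇒_) (residuation x y w) ⟩
    z ⇒ (y ⇒ (x ⇒ w))  ≡⟨ sym (residuation y z (x ⇒ w)) ⟩
    (y * z) ⇒ (x ⇒ w)  ≡⟨ sym (residuation x (y * z) w) ⟩
    (x * (y * z)) ⇒ w  ∎

  -- Three-potence is the contraction rule (C) read through residuation.
  *-three-potent : ∀ x → (x * x) ⊑ ((x * x) * x)
  *-three-potent x = begin
    (x * x) ⇒ w            ≡⟨ residuation x x w ⟩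
    x ⇒ (x ⇒ w)            ≡⟨ rC x w x⇒x⇒x⇒w ⟩
    𝟙                      ∎
    where
    w : A
    w = (x * x) * x
    x⇒x⇒x⇒w : x ⇒ (x ⇒ (x ⇒ w)) ≡ 𝟙
    x⇒x⇒x⇒w = begin
      x ⇒ (x ⇒ (x ⇒ w))    ≡⟨ cong (x ⇒_) (sym (residuation x x w)) ⟩
      x ⇒ ((x * x) ⇒ w)    ≡⟨ sym (residuation (x * x) x w) ⟩
      w ⇒ w                ≡⟨ A1 w ⟩
      𝟙                    ∎

  ⇒𝟘-involutive : ∀ x → (x ⇒ 𝟘) ⇒ 𝟘 ≡ x
  ⇒𝟘-involutive x = begin
    (x ⇒ 𝟘) ⇒ 𝟘    ≡⟨ ⇒𝟘≡¬ (x ⇒ 𝟘) ⟩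
    ¬ (x ⇒ 𝟘)      ≡⟨ cong ¬_ (⇒𝟘≡¬ x) ⟩
    ¬ (¬ x)        ≡⟨ double-negation x ⟩
    x              ∎

proposition3p7 : {a : Level} {A : Set a} (_∧_ _∨_ _⇒_ : Op₂ A) (¬_ : Op₁ A) (𝟘 𝟙 : A) →
    IsSAlgebra _∧_ _∨_ _⇒_ ¬_ 𝟘 𝟙 →
    IsS'Algebra _∧_ _∨_ (λ x y → ¬ (x ⇒ (¬ y))) _⇒_ 𝟘 𝟙
proposition3p7 _∧_ _∨_ _⇒_ ¬_ 𝟘 𝟙 S = record
  { isLattice           = isAlgLattice
  ; top                 = λ x → ⊑⇒∧-order (r⇒r x 𝟙 refl)
  ; isCommutativeMonoid = record
    { isMonoid = record
      { isSemigroup = record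
        { isMagma = record { isEquivalence = isEquivalence ; ∙-cong = cong₂ _*_ }
        ; assoc   = *-assoc
        }
      ; identity = *-identityˡ , *-identityʳ
      }
    ; comm = *-comm
    }
  ; residuation₁ = λ x y z x*y≤z →
      ⊑⇒∧-order (trans (sym (residuation x y z)) (∧-order⇒⊑ x*y≤z))
  ; residuation₂ = λ x y z y≤x⇒z →
      ⊑⇒∧-order (trans (residuation x y z) (∧-order⇒⊑ y≤x⇒z))
  ; bottom       = λ x → ⊑⇒∧-order (A2 x)
  ; involutive   = ⇒𝟘-involutive
  ; three-potent = λ x → ⊑⇒∧-order (*-three-potent x)
  }
  where
  open IsSAlgebra S using (A2; r⇒r)
  open SAlgebraProperties _∧_ _∨_ _⇒_ ¬_ 𝟘 𝟙 S
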